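{- Let $k\geq 2$ and $2\le i\le k$ be integers, $\lambda$ a positive integer, and $a_{k,n}^{i}$ the $i$-th sequence of generalized order-$k$ numbers defined in the context. Let $\iota=\sqrt{ -1}$. For $m\ge1$ let $Q_{k,m}=(q_{st})$ be the $m\times m$ matrix with $q_{st}=\iota^{|s-t|}$ if $-1\le s-t<k$ and $s\ne t$, $q_{ss}=\lambda$, and $q_{st}=0$ otherwise. For $n\ge 2$ let $Q_{k,n}^{i}$ be the $n\times n$ matrix whose first row is $(1,\iota,0,\dots,0)$, whose first column has entry $\iota^{r-1}$ in row $r$ for $1\le r\le \min(n,k-i+1)$ and $0$ in the remaining rows, and whose submatrix obtained by deleting the first row and first column is $Q_{k,n-1}$. Then $\det(Q_{k,n}^{i})=a_{k,n}^{i}$.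
   Context: For a positive integer $k$ and a positive integer $\lambda$, the $k$ sequences of generalized order-$k$ numbers are defined as follows: for each $1\le i\le k$, the sequence $(a_{k,n}^{i})_{n\ge 1-k}$ has initial values $a_{k,n}^{i}=1$ if $i=1-n$ and $a_{k,n}^{i}=0$ otherwise, for $1-k\le n\le 0$, and satisfies $a_{k,n}^{i}=\lambda a_{k,n-1}^{i}+a_{k,n-2}^{i}+\cdots+a_{k,n-k}^{i}$ for $n\ge 1$. -}

module Defs where

open import Data.Nat as ℕ using (ℕ; zero; suc; _≤_; _<_; _≟_; _<?_; _≤?_)
open import Data.Integer as ℤ using (ℤ; +_)
open import Data.Fin using (Fin; zero; suc; toℕ; punchIn)
open import Data.List using (List; []; _∷_; take; drop)
open import Data.Nat.ListAction using (sum)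
open import Data.Bool using (if_then_else_)
open import Relation.Nullary using (does)

infix 5 _+ι_

record ℤι : Set where
  constructor _+ι_
  field
    re : ℤ
    im : ℤ

open ℤι public

infixl 6 _⊕_
infixl 7 _⊗_

_⊕_ : ℤι → ℤι → ℤι
(a +ι b) ⊕ (c +ι d) = (a ℤ.+ c) +ι (b ℤ.+ d)

_⊗_ : ℤι → ℤι → ℤι
(a +ι b) ⊗ (c +ι d) = ((a ℤ.* c) ℤ.- (b ℤ.* d)) +ι ((a ℤ.* d) ℤ.+ (b ℤ.* c))

⊖_ : ℤι → ℤι
⊖ (a +ι b) = (ℤ.- a) +ι (ℤ.- b)

0ι 1ι ι : ℤι
0ι = + 0 +ι + 0
1ι = + 1 +ι + 0
ι  = + 0 +ι + 1

fromℕ : ℕ → ℤι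
fromℕ n = + n +ι + 0

ιpow : ℕ → ℤι
ιpow zero    = 1ι
ιpow (suc d) = ι ⊗ ιpow d

Matrix : ℕ → Set
Matrix n = Fin n → Fin n → ℤι

sumFin : ∀ n → (Fin n → ℤι) → ℤι
sumFin zero    f = 0ι
sumFin (suc n) f = f zero ⊕ sumFin n (λ j → f (suc j))

sign : ℕ → ℤι
sign zero    = 1ι
sign (suc j) = ⊖ sign j

minor : ∀ {n} → Fin (suc n) → Matrix (suc n) → Matrix n
minor j M r c = M (suc r) (punchIn j c)

det : ∀ n → Matrix n → ℤι
det zero    M = 1ι
det (suc n) M =
  sumFin (suc n) (λ j → sign (toℕ j) ⊗ M zero j ⊗ det n (minor j M))

-- Generalized order-k numbers a^i_{k,n}.
-- We use the shifted index m = n + k - 1 (so m ≥ 0 ⇔ n ≥ 1 - k).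
-- hist k λ i m = [b m , b (m-1) , … , b 0]  where b m = a^i_{k, m+1-k}.
-- Initial values (m < k, i.e. 1-k ≤ n ≤ 0): b m = 1 iff i = 1 - n = k - m.

initVal : ℕ → ℕ → ℕ → ℕ
initVal k i m = if does (i ≟ k ℕ.∸ m) then 1 else 0

hist : (k lam i : ℕ) → ℕ → List ℕ
hist k lam i zero = initVal k i 0 ∷ []
hist k lam i (suc m) with hist k lam i m
... | [] = []    -- impossible: the history is never empty
... | (x ∷ xs) =
  (if does (suc m <? k)
     then initVal k i (suc m)
     else lam ℕ.* x ℕ.+ sum (take (k ℕ.∸ 1) xs))
  ∷ (x ∷ xs)

headℕ : List ℕ → ℕ
headℕ []      = 0
headℕ (x ∷ _) = x

b : (k lam i : ℕ) → ℕ → ℕ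
b k lam i m = headℕ (hist k lam i m)

a : (k lam i n : ℕ) → ℕ
a k lam i n = b k lam i (n ℕ.+ k ℕ.∸ 1)

-- The matrices.  Indices are 0-based (Fin m); s - t is unaffected.
-- Q_{k,m}: q_st = λ if s = t; ι^{|s-t|} if -1 ≤ s - t < k and s ≠ t;
-- 0 otherwise.

Q : (k lam m : ℕ) → Matrix m
Q k lam m s t =
  if does (toℕ s ≟ toℕ t) then fromℕ lam
  else if does (toℕ t ≟ suc (toℕ s)) then ι
  else if does (toℕ t <? toℕ s) then
         (if does (toℕ s ℕ.∸ toℕ t <? k) then ιpow (toℕ s ℕ.∸ toℕ t) else 0ι)
  else 0ι

Qi : (k lam i n : ℕ) → Matrix n
Qi k lam i (suc m) zero zero             = 1ι
Qi k lam i (suc m) zero (suc zero)       = ι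
Qi k lam i (suc m) zero (suc (suc _))    = 0ι
-- row r = toℕ r' + 2 (1-based); r ≤ n holds automatically
Qi k lam i (suc m) (suc r') zero =
  if does (toℕ r' ℕ.+ 2 ≤? k ℕ.∸ i ℕ.+ 1) then ιpow (toℕ r' ℕ.+ 1) else 0ι
Qi k lam i (suc m) (suc r') (suc t') = Q k lam m r' t'

module Submission where

-- Expand along the first row, which is (c₀, ι, 0, …, 0): the n × n matrix made of Q_{k,n−1}
-- and a first column (c₀, c₁, …) has determinant c₀ det Q_{k,n−1} − ι det(the matrix of the
-- same shape of size n − 1 with first column (c₁, c₂, …)).  If c_j = ι^j w_j the factors
-- −ι · ι = 1 cancel and the determinant is Σ_{j<n} w_j det Q_{k,n−1−j}.  Both Q^i_{k,n}
-- (weights [i + j ≤ k]) and Q_{k,n} (weights λ, then [2 + j ≤ k]) have this shape, so by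
-- induction det Q_{k,n} = a¹_{k,n} and det Q^i_{k,n} = a^i_{k,n}, once
-- a^i_{k,n} = Σ_{j<n} [i + j ≤ k] a¹_{k,n−1−j} for 2 ≤ i ≤ k + 1.  That identity follows from
-- a¹_{n+1} = λ a¹_n + a²_n, a^i_{n+1} = a¹_n + a^{i+1}_n and a^{k+1} = 0; each holds because
-- both sides satisfy the order-k recurrence and agree on the k initial values.

open import Data.Bool using (true; false; if_then_else_)
open import Data.Fin using (Fin; zero; suc; toℕ; punchIn)
open import Data.Fin.Properties using (toℕ<n)
open import Data.Integer using (+_)
import Data.Integer.Properties as ℤ
open import Data.Integer.Solver using (module +-*-Solver)
open import Data.List using (_∷_; take; drop)
open import Data.Nat using (ℕ; zero; suc; _+_; _*_; _∸_; _≤_; _<_; z≤n; s≤s)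
open import Data.Nat.Induction using (<-rec)
open import Data.Nat.ListAction using () renaming (sum to sumList)
open import Data.Nat.Properties
open import Data.Nat.Tactic.RingSolver using (solve-∀)
open import Data.Product using (∃₂; _,_)
open import Data.Sum using (inj₁; inj₂)
open import Function using (_∘_; _⇔_; mk⇔)
open import Relation.Binary.PropositionalEquality
open import Relation.Nullary using (yes; no; does)
open import Relation.Nullary.Decidable using (dec-true; dec-false; does-⇔)

open import Defs

open import Algebra.Properties.Semiring.Sum +-*-semiring
  using (sum-syntax; sum-cong-≗; sum-replicate-zero; ∑-distrib-+; *-distribˡ-sum)
open +-*-Solver using (solve; _:=_; _:+_; _:*_; _:-_; con)
open ≡-Reasoning

⊗-comm : ∀ x y → x ⊗ y ≡ y ⊗ x
⊗-comm (a +ι b) (c +ι d) = cong₂ _+ι_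
  (solve 4 (λ a b c d → a :* c :- b :* d := c :* a :- d :* b) refl a b c d)
  (solve 4 (λ a b c d → a :* d :+ b :* c := c :* b :+ d :* a) refl a b c d)

⊗-assoc : ∀ x y z → x ⊗ y ⊗ z ≡ x ⊗ (y ⊗ z)
⊗-assoc (a +ι b) (c +ι d) (e +ι f) = cong₂ _+ι_
  (solve 6 (λ a b c d e f → (a :* c :- b :* d) :* e :- (a :* d :+ b :* c) :* f
                          := a :* (c :* e :- d :* f) :- b :* (c :* f :+ d :* e)) refl a b c d e f)
  (solve 6 (λ a b c d e f → (a :* c :- b :* d) :* f :+ (a :* d :+ b :* c) :* e
                          := a :* (c :* f :+ d :* e) :+ b :* (c :* e :- d :* f)) refl a b c d e f)

⊗-identityʳ : ∀ x → x ⊗ 1ι ≡ x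
⊗-identityʳ (a +ι b) = cong₂ _+ι_
  (solve 2 (λ a b → a :* con (+ 1) :- b :* con (+ 0) := a) refl a b)
  (solve 2 (λ a b → a :* con (+ 0) :+ b :* con (+ 1) := b) refl a b)

⊗-identityˡ : ∀ x → 1ι ⊗ x ≡ x
⊗-identityˡ x = trans (⊗-comm 1ι x) (⊗-identityʳ x)

⊗-zeroʳ : ∀ x → x ⊗ 0ι ≡ 0ι
⊗-zeroʳ (a +ι b) = cong₂ _+ι_
  (solve 2 (λ a b → a :* con (+ 0) :- b :* con (+ 0) := con (+ 0)) refl a b)
  (solve 2 (λ a b → a :* con (+ 0) :+ b :* con (+ 0) := con (+ 0)) refl a b)

⊗-zeroˡ : ∀ x → 0ι ⊗ x ≡ 0ι
⊗-zeroˡ x = trans (⊗-comm 0ι x) (⊗-zeroʳ x)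

⊕-identityʳ : ∀ x → x ⊕ 0ι ≡ x
⊕-identityʳ (a +ι b) = cong₂ _+ι_ (ℤ.+-identityʳ a) (ℤ.+-identityʳ b)

⊗-distribˡ-⊕ : ∀ x y z → x ⊗ (y ⊕ z) ≡ x ⊗ y ⊕ x ⊗ z
⊗-distribˡ-⊕ (a +ι b) (c +ι d) (e +ι f) = cong₂ _+ι_
  (solve 6 (λ a b c d e f → a :* (c :+ e) :- b :* (d :+ f)
                          := (a :* c :- b :* d) :+ (a :* e :- b :* f)) refl a b c d e f)
  (solve 6 (λ a b c d e f → a :* (d :+ f) :+ b :* (c :+ e)
                          := (a :* d :+ b :* c) :+ (a :* f :+ b :* e)) refl a b c d e f)

fromℕ-+ : ∀ m n → fromℕ (m + n) ≡ fromℕ m ⊕ fromℕ n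
fromℕ-+ m n = cong₂ _+ι_ (ℤ.pos-+ m n) refl

fromℕ-* : ∀ m n → fromℕ (m * n) ≡ fromℕ m ⊗ fromℕ n
fromℕ-* m n = cong₂ _+ι_
  (trans (ℤ.pos-* m n) (solve 2 (λ a b → a :* b := a :* b :- con (+ 0) :* con (+ 0)) refl (+ m) (+ n)))
  (solve 2 (λ a b → con (+ 0) := a :* con (+ 0) :+ con (+ 0) :* b) refl (+ m) (+ n))

-- The third step is ι ⊗ (⊖ 1ι ⊗ ι) = 1ι, by computation.
ι-cancel : ∀ u x → ⊖ 1ι ⊗ ι ⊗ (u ⊗ ι ⊗ x) ≡ u ⊗ x
ι-cancel u x = begin
  ⊖ 1ι ⊗ ι ⊗ (u ⊗ ι ⊗ x)    ≡⟨ ⊗-assoc (⊖ 1ι ⊗ ι) (u ⊗ ι) x ⟨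
  ⊖ 1ι ⊗ ι ⊗ (u ⊗ ι) ⊗ x    ≡⟨ cong (_⊗ x) (⊗-comm (⊖ 1ι ⊗ ι) (u ⊗ ι)) ⟩
  u ⊗ ι ⊗ (⊖ 1ι ⊗ ι) ⊗ x    ≡⟨ cong (_⊗ x) (⊗-assoc u ι (⊖ 1ι ⊗ ι)) ⟩
  u ⊗ 1ι ⊗ x                ≡⟨ cong (_⊗ x) (⊗-identityʳ u) ⟩
  u ⊗ x                     ∎

if-else-0ι : ∀ b x → (if b then x else 0ι) ≡ x ⊗ fromℕ (if b then 1 else 0)
if-else-0ι true  x = sym (⊗-identityʳ x)
if-else-0ι false x = sym (⊗-zeroʳ x)

sumFin-cong : ∀ n {f g : Fin n → ℤι} → (∀ j → f j ≡ g j) → sumFin n f ≡ sumFin n g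
sumFin-cong zero    f≗g = refl
sumFin-cong (suc n) f≗g = cong₂ _⊕_ (f≗g zero) (sumFin-cong n (f≗g ∘ suc))

sumFin-zero : ∀ n {f : Fin n → ℤι} → (∀ j → f j ≡ 0ι) → sumFin n f ≡ 0ι
sumFin-zero zero    f≗0 = refl
sumFin-zero (suc n) f≗0 = cong₂ _⊕_ (f≗0 zero) (sumFin-zero n (f≗0 ∘ suc))

det-cong : ∀ n {M N : Matrix n} → (∀ r c → M r c ≡ N r c) → det n M ≡ det n N
det-cong zero    M≗N = refl
det-cong (suc n) M≗N = sumFin-cong (suc n) λ j →
  cong₂ (λ x y → sign (toℕ j) ⊗ x ⊗ y) (M≗N zero j) (det-cong n (λ r c → M≗N (suc r) (punchIn j c)))

det-singleton : (M : Matrix 1) → det 1 M ≡ M zero zero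
det-singleton M = begin
  1ι ⊗ M zero zero ⊗ 1ι ⊕ 0ι  ≡⟨ ⊕-identityʳ (1ι ⊗ M zero zero ⊗ 1ι) ⟩
  1ι ⊗ M zero zero ⊗ 1ι       ≡⟨ ⊗-identityʳ (1ι ⊗ M zero zero) ⟩
  1ι ⊗ M zero zero            ≡⟨ ⊗-identityˡ (M zero zero) ⟩
  M zero zero                 ∎

det-expand-first-row₂ : ∀ m (M : Matrix (suc (suc m))) → (∀ j → M zero (suc (suc j)) ≡ 0ι) →
  det (suc (suc m)) M ≡
    M zero zero ⊗ det (suc m) (minor zero M) ⊕ ⊖ 1ι ⊗ M zero (suc zero) ⊗ det (suc m) (minor (suc zero) M)
det-expand-first-row₂ m M row₀ = cong₂ _⊕_
  (cong (_⊗ D zero) (⊗-identityˡ (M zero zero)))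
  (trans (cong (_⊕_ (⊖ 1ι ⊗ M zero (suc zero) ⊗ D (suc zero))) (sumFin-zero m vanishing))
         (⊕-identityʳ (⊖ 1ι ⊗ M zero (suc zero) ⊗ D (suc zero))))
  where
  D : Fin (suc (suc m)) → ℤι
  D j = det (suc m) (minor j M)
  vanishing : ∀ j → sign (2 + toℕ j) ⊗ M zero (suc (suc j)) ⊗ D (suc (suc j)) ≡ 0ι
  vanishing j = begin
    s ⊗ M zero (suc (suc j)) ⊗ d  ≡⟨ cong (λ x → s ⊗ x ⊗ d) (row₀ j) ⟩
    s ⊗ 0ι ⊗ d                    ≡⟨ cong (_⊗ d) (⊗-zeroʳ s) ⟩
    0ι ⊗ d                        ≡⟨ ⊗-zeroˡ d ⟩
    0ι                            ∎
    where
    s d : ℤι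
    s = sign (2 + toℕ j)
    d = D (suc (suc j))

∸-suc : ∀ {m j} → j < m → m ∸ j ≡ suc (m ∸ suc j)
∸-suc {suc m} (s≤s j≤m) = +-∸-assoc 1 j≤m

module Recurrence (k′ lam : ℕ) where

  k : ℕ
  k = suc k′

  preceding : (ℕ → ℕ) → ℕ → ℕ
  preceding x m = ∑[ j < k′ ] x (m ∸ suc (toℕ j))

  preceding-cong : ∀ x y m n → (∀ j → j < k′ → x (m ∸ suc j) ≡ y (n ∸ suc j)) →
                   preceding x m ≡ preceding y n
  preceding-cong x y m n x≗y =
    sum-cong-≗ {k′} {λ j → x (m ∸ suc (toℕ j))} {λ j → y (n ∸ suc (toℕ j))}
      (λ j → x≗y (toℕ j) (toℕ<n j))

  preceding-linear : ∀ α x y m → preceding (λ l → α * x l + y l) m ≡ α * preceding x m + preceding y m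
  preceding-linear α x y m = begin
    ∑[ j < k′ ] (α * x (m ∸ suc (toℕ j)) + y (m ∸ suc (toℕ j)))
      ≡⟨ ∑-distrib-+ {k′} (λ j → α * x (m ∸ suc (toℕ j))) (λ j → y (m ∸ suc (toℕ j))) ⟩
    ∑[ j < k′ ] (α * x (m ∸ suc (toℕ j))) + preceding y m
      ≡⟨ cong (_+ preceding y m) (*-distribˡ-sum {k′} α (λ j → x (m ∸ suc (toℕ j)))) ⟨
    α * preceding x m + preceding y m
      ∎

  Recurrent : (ℕ → ℕ) → Set
  Recurrent x = ∀ m → k′ ≤ m → x (suc m) ≡ lam * x m + preceding x m

  recurrent-unique : ∀ {x y} → Recurrent x → Recurrent y →
                     (∀ m → m < k → x m ≡ y m) → ∀ m → x m ≡ y m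
  recurrent-unique {x} {y} rx ry initial = <-rec (λ m → x m ≡ y m) step
    where
    step : ∀ m → (∀ {l} → l < m → x l ≡ y l) → x m ≡ y m
    step zero    _   = initial zero (s≤s z≤n)
    step (suc m) rec with k′ ≤? m
    ... | no  k′≰m = initial (suc m) (s≤s (≰⇒> k′≰m))
    ... | yes k′≤m = begin
      x (suc m)                    ≡⟨ rx m k′≤m ⟩
      lam * x m + preceding x m    ≡⟨ cong₂ (λ u v → lam * u + v) (rec ≤-refl)
                                        (preceding-cong x y m m λ j _ → rec (s≤s (m∸n≤m m (suc j)))) ⟩
      lam * y m + preceding y m    ≡⟨ ry m k′≤m ⟨
      y (suc m)                    ∎

  recurrent-zero : Recurrent (λ _ → 0)
  recurrent-zero m _ = sym (cong₂ _+_ (*-zeroʳ lam) (sum-replicate-zero k′))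

  recurrent-shift : ∀ {x} → Recurrent x → Recurrent (x ∘ suc)
  recurrent-shift {x} rx m k′≤m = begin
    x (suc (suc m))                          ≡⟨ rx (suc m) (m≤n⇒m≤1+n k′≤m) ⟩
    lam * x (suc m) + preceding x (suc m)    ≡⟨ cong (_+_ (lam * x (suc m))) (preceding-cong x (x ∘ suc) (suc m) m
                                                  λ j j<k′ → cong x (∸-suc (<-≤-trans j<k′ k′≤m))) ⟩
    lam * x (suc m) + preceding (x ∘ suc) m  ∎

  recurrent-linear : ∀ α {x y} → Recurrent x → Recurrent y → Recurrent (λ m → α * x m + y m)
  recurrent-linear α {x} {y} rx ry m k′≤m = begin
    α * x (suc m) + y (suc m)                      ≡⟨ cong₂ (λ u v → α * u + v) (rx m k′≤m) (ry m k′≤m) ⟩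
    α * (lam * x m + X) + (lam * y m + Y)          ≡⟨ rearrange α lam (x m) X (y m) Y ⟩
    lam * (α * x m + y m) + (α * X + Y)            ≡⟨ cong (_+_ (lam * (α * x m + y m))) (preceding-linear α x y m) ⟨
    lam * (α * x m + y m) + preceding (λ l → α * x l + y l) m ∎
    where
    X Y : ℕ
    X = preceding x m
    Y = preceding y m
    rearrange : ∀ α l u U v V → α * (l * u + U) + (l * v + V) ≡ l * (α * u + v) + (α * U + V)
    rearrange = solve-∀

  hist-cons : ∀ i m → ∃₂ λ x xs → hist k lam i m ≡ x ∷ xs
  hist-cons i zero = _ , _ , refl
  hist-cons i (suc m) with hist k lam i m | hist-cons i m
  ... | _ | _ , _ , refl = _ , _ , refl

  hist-suc : ∀ i m → hist k lam i (suc m) ≡ b k lam i (suc m) ∷ hist k lam i m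
  hist-suc i m with hist k lam i m | hist-cons i m
  ... | _ | _ , _ , refl = refl

  b-suc : ∀ i m → b k lam i (suc m) ≡
    (if does (suc m <? k) then initVal k i (suc m)
     else lam * b k lam i m + sumList (take k′ (drop 1 (hist k lam i m))))
  b-suc i m with hist k lam i m | hist-cons i m
  ... | _ | _ , _ , refl = refl

  b-initial : ∀ i m → m < k → b k lam i m ≡ initVal k i m
  b-initial i zero    _   = refl
  b-initial i (suc m) m<k rewrite b-suc i m | dec-true (suc m <? k) m<k = refl

  sum-take-hist : ∀ i n m → n ≤ suc m → sumList (take n (hist k lam i m)) ≡ ∑[ j < n ] b k lam i (m ∸ toℕ j)
  sum-take-hist i zero    m       _         = refl
  sum-take-hist i (suc n) zero    (s≤s z≤n) = refl
  sum-take-hist i (suc n) (suc m) (s≤s n≤m) rewrite hist-suc i m =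
    cong (_+_ (b k lam i (suc m))) (sum-take-hist i n m n≤m)

  b-recurrent : ∀ i → Recurrent (b k lam i)
  b-recurrent i m k′≤m rewrite b-suc i m | dec-false (suc m <? k) (≤⇒≯ (s≤s k′≤m)) =
    cong (_+_ (lam * b k lam i m)) (sum-preceding m k′≤m)
    where
    sum-preceding : ∀ m → k′ ≤ m → sumList (take k′ (drop 1 (hist k lam i m))) ≡ preceding (b k lam i) m
    sum-preceding zero    z≤n  = refl
    sum-preceding (suc m) k′≤m rewrite hist-suc i m = sum-take-hist i k′ m k′≤m

  relation-from-window : ∀ α p q r →
    (∀ m → m < k → b k lam p (suc m) ≡ α * b k lam q m + b k lam r m) →
    ∀ m → b k lam p (suc m) ≡ α * b k lam q m + b k lam r m
  relation-from-window α p q r =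
    recurrent-unique (recurrent-shift (b-recurrent p)) (recurrent-linear α (b-recurrent q) (b-recurrent r))

δ : ℕ → ℕ → ℕ
δ i j = if does (i ≟ j) then 1 else 0

∑-δ : ∀ {n} c → c < n → ∑[ j < n ] δ c (toℕ j) ≡ 1
∑-δ {suc n} zero    _         = cong suc (sum-replicate-zero n)
∑-δ {suc n} (suc c) (s≤s c<n) = ∑-δ c c<n

module Sequences (n lam : ℕ) where

  open Recurrence (suc n) lam public

  b-window : ∀ i m → m ≤ suc n → b k lam i m ≡ δ i (suc (suc n ∸ m))
  b-window i m m≤1+n = trans (b-initial i m (s≤s m≤1+n)) (cong (δ i) (+-∸-assoc 1 m≤1+n))

  b-early : ∀ i m → m ≤ n → b k lam i m ≡ δ i (suc (suc (n ∸ m)))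
  b-early i m m≤n = trans (b-window i m (m≤n⇒m≤1+n m≤n)) (cong (δ i ∘ suc) (+-∸-assoc 1 m≤n))

  b-last : ∀ i → b k lam i (suc n) ≡ δ i 1
  b-last i = trans (b-window i (suc n) ≤-refl) (cong (δ i ∘ suc) (n∸n≡0 (suc n)))

  b-at-k : ∀ i → b k lam i k ≡ lam * δ i 1 + ∑[ j < suc n ] δ i (2 + toℕ j)
  b-at-k i = begin
    b k lam i k                                   ≡⟨ b-recurrent i (suc n) ≤-refl ⟩
    lam * b k lam i (suc n) + preceding (b k lam i) (suc n)
                                                  ≡⟨ cong₂ (λ u v → lam * u + v) (b-last i)
                                                       (sum-cong-≗ {suc n} {λ j → b k lam i (n ∸ toℕ j)}
                                                                            {λ j → δ i (2 + toℕ j)} earlier) ⟩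
    lam * δ i 1 + ∑[ j < suc n ] δ i (2 + toℕ j)  ∎
    where
    earlier : ∀ j → b k lam i (n ∸ toℕ j) ≡ δ i (2 + toℕ j)
    earlier j = trans (b-early i (n ∸ toℕ j) (m∸n≤m n (toℕ j)))
                      (cong (λ l → δ i (2 + l)) (m∸[m∸n]≡n (≤-pred (toℕ<n j))))

  window-one : ∀ m → m < k → b k lam 1 (suc m) ≡ lam * b k lam 1 m + b k lam 2 m
  window-one m m<k with m≤n⇒m<n∨m≡n (≤-pred m<k)
  ... | inj₁ (s≤s m≤n) = begin
    b k lam 1 (suc m)                  ≡⟨ b-window 1 (suc m) (s≤s m≤n) ⟩
    δ 0 (n ∸ m)                        ≡⟨ cong (_+ δ 0 (n ∸ m)) (*-zeroʳ lam) ⟨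
    lam * 0 + δ 0 (n ∸ m)              ≡⟨ cong₂ (λ u v → lam * u + v) (b-early 1 m m≤n) (b-early 2 m m≤n) ⟨
    lam * b k lam 1 m + b k lam 2 m    ∎
  ... | inj₂ refl = begin
    b k lam 1 k                                    ≡⟨ b-at-k 1 ⟩
    lam * 1 + ∑[ j < suc n ] 0                     ≡⟨ cong (_+_ (lam * 1)) (sum-replicate-zero (suc n)) ⟩
    lam * 1 + 0                                    ≡⟨ cong₂ (λ u v → lam * u + v) (b-last 1) (b-last 2) ⟨
    lam * b k lam 1 (suc n) + b k lam 2 (suc n)    ∎

  window-high : ∀ i → i ≤ n → ∀ m → m < k →
    b k lam (2 + i) (suc m) ≡ 1 * b k lam 1 m + b k lam (3 + i) m
  window-high i i≤n m m<k with m≤n⇒m<n∨m≡n (≤-pred m<k)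
  ... | inj₁ (s≤s m≤n) = begin
    b k lam (2 + i) (suc m)                   ≡⟨ b-window (2 + i) (suc m) (s≤s m≤n) ⟩
    δ (1 + i) (n ∸ m)
      ≡⟨ cong₂ (λ u v → 1 * u + v) (b-early 1 m m≤n) (b-early (3 + i) m m≤n) ⟨
    1 * b k lam 1 m + b k lam (3 + i) m       ∎
  ... | inj₂ refl = begin
    b k lam (2 + i) k                                   ≡⟨ b-at-k (2 + i) ⟩
    lam * 0 + ∑[ j < suc n ] δ i (toℕ j)                ≡⟨ cong₂ _+_ (*-zeroʳ lam) (∑-δ i (s≤s i≤n)) ⟩
    1                                                   ≡⟨ cong₂ (λ u v → 1 * u + v) (b-last 1) (b-last (3 + i)) ⟨
    1 * b k lam 1 (suc n) + b k lam (3 + i) (suc n)     ∎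

  b-vanishes : ∀ i → k < i → ∀ m → b k lam i m ≡ 0
  b-vanishes i k<i = recurrent-unique (b-recurrent i) recurrent-zero initial
    where
    initial : ∀ m → m < k → b k lam i m ≡ 0
    initial m m<k = trans (b-initial i m m<k) (cong (if_then 1 else 0)
      (dec-false (i ≟ k ∸ m) λ i≡k∸m → <⇒≱ k<i (≤-trans (≤-reflexive i≡k∸m) (m∸n≤m k m))))

  a₁ : ℕ → ℕ
  a₁ = a k lam 1

  a-as-b : ∀ i m → a k lam i m ≡ b k lam i (m + suc n)
  a-as-b i m = cong (b k lam i) (+-∸-assoc m (s≤s z≤n))

  a-relation : ∀ α p q r → (∀ m → m < k → b k lam p (suc m) ≡ α * b k lam q m + b k lam r m) →
               ∀ m → a k lam p (suc m) ≡ α * a k lam q m + a k lam r m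
  a-relation α p q r window m = begin
    a k lam p (suc m)                               ≡⟨ a-as-b p (suc m) ⟩
    b k lam p (suc (m + suc n))                     ≡⟨ relation-from-window α p q r window (m + suc n) ⟩
    α * b k lam q (m + suc n) + b k lam r (m + suc n) ≡⟨ cong₂ (λ u v → α * u + v) (a-as-b q m) (a-as-b r m) ⟨
    α * a k lam q m + a k lam r m                   ∎

  a₁-zero : a₁ 0 ≡ 1
  a₁-zero = b-last 1

  a₁-suc : ∀ m → a₁ (suc m) ≡ lam * a₁ m + a k lam 2 m
  a₁-suc = a-relation lam 1 1 2 window-one

  a-suc : ∀ i → 2 ≤ i → i ≤ k → ∀ m → a k lam i (suc m) ≡ 1 * a₁ m + a k lam (suc i) m
  a-suc (suc (suc i)) (s≤s (s≤s _)) (s≤s (s≤s i≤n)) = a-relation 1 (2 + i) 1 (3 + i) (window-high i i≤n)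

  weight : ℕ → ℕ → ℕ
  weight i j = if does (i + j ≤? k) then 1 else 0

  weight-zero : ∀ {i} → i ≤ k → weight i 0 ≡ 1
  weight-zero {i} i≤k =
    cong (if_then 1 else 0) (dec-true (i + 0 ≤? k) (subst (_≤ k) (sym (+-identityʳ i)) i≤k))

  weight-suc : ∀ i j → weight i (suc j) ≡ weight (suc i) j
  weight-suc i j = cong (λ l → if does (l ≤? k) then 1 else 0) (+-suc i j)

  weight-beyond : ∀ j → weight (suc k) j ≡ 0
  weight-beyond j =
    cong (if_then 1 else 0) (dec-false (suc k + j ≤? k) λ le → <-irrefl refl (≤-trans (m≤m+n (suc k) j) le))

  convolve : (ℕ → ℕ) → ℕ → ℕ
  convolve w m = ∑[ j < m ] (w (toℕ j) * a₁ (m ∸ suc (toℕ j)))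

  convolve-cong : ∀ v w m → (∀ j → v j ≡ w j) → convolve v m ≡ convolve w m
  convolve-cong v w m v≗w = sum-cong-≗ {m} {λ j → v (toℕ j) * a₁ (m ∸ suc (toℕ j))}
    {λ j → w (toℕ j) * a₁ (m ∸ suc (toℕ j))} (λ j → cong (_* a₁ (m ∸ suc (toℕ j))) (v≗w (toℕ j)))

  a-convolution : ∀ i m → 2 ≤ i → i ≤ suc k → a k lam i m ≡ convolve (weight i) m
  a-convolution i zero (s≤s (s≤s _)) _ = b-last i
  a-convolution i (suc m) 2≤i i≤1+k with m≤n⇒m<n∨m≡n i≤1+k
  ... | inj₂ refl = begin
    a k lam (suc k) (suc m)              ≡⟨ a-as-b (suc k) (suc m) ⟩
    b k lam (suc k) (suc m + suc n)      ≡⟨ b-vanishes (suc k) ≤-refl (suc m + suc n) ⟩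
    0                                    ≡⟨ sum-replicate-zero (suc m) ⟨
    convolve (λ _ → 0) (suc m)           ≡⟨ convolve-cong (weight (suc k)) (λ _ → 0) (suc m) weight-beyond ⟨
    convolve (weight (suc k)) (suc m)    ∎
  ... | inj₁ (s≤s i≤k) = begin
    a k lam i (suc m)                                  ≡⟨ a-suc i 2≤i i≤k m ⟩
    1 * a₁ m + a k lam (suc i) m                       ≡⟨ cong₂ (λ u v → u * a₁ m + v) (sym (weight-zero i≤k))
                                                            (a-convolution (suc i) m (m≤n⇒m≤1+n 2≤i) (s≤s i≤k)) ⟩
    weight i 0 * a₁ m + convolve (weight (suc i)) m    ≡⟨ cong (_+_ (weight i 0 * a₁ m))
                                                            (convolve-cong (weight i ∘ suc) (weight (suc i)) m (weight-suc i)) ⟨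
    convolve (weight i) (suc m)                        ∎

module Determinants (n lam : ℕ) where

  open Sequences n lam public

  bordered : (ℕ → ℤι) → (m : ℕ) → Matrix m
  bordered c (suc m) zero    zero          = c 0
  bordered c (suc m) zero    (suc zero)    = ι
  bordered c (suc m) zero    (suc (suc _)) = 0ι
  bordered c (suc m) (suc r) zero          = c (suc (toℕ r))
  bordered c (suc m) (suc r) (suc t)       = Q k lam m r t

  minor-bordered : ∀ c m r t → minor (suc zero) (bordered c (suc (suc m))) r t ≡ bordered (c ∘ suc) (suc m) r t
  minor-bordered c m zero    zero          = refl
  minor-bordered c m zero    (suc zero)    = refl
  minor-bordered c m zero    (suc (suc t)) = refl
  minor-bordered c m (suc r) zero          = refl
  minor-bordered c m (suc r) (suc t)       = refl

  Q-column : ℕ → ℤι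
  Q-column zero    = fromℕ lam
  Q-column (suc j) = if does (suc j <? k) then ιpow (suc j) else 0ι

  Q-bordered : ∀ m r t → Q k lam (suc m) r t ≡ bordered Q-column (suc m) r t
  Q-bordered m zero    zero          = refl
  Q-bordered m zero    (suc zero)    = refl
  Q-bordered m zero    (suc (suc t)) = refl
  Q-bordered m (suc r) zero          = refl
  Q-bordered m (suc r) (suc t)       = refl

  Qi-column : ℕ → ℕ → ℤι
  Qi-column i zero    = 1ι
  Qi-column i (suc j) = if does (j + 2 ≤? k ∸ i + 1) then ιpow (j + 1) else 0ι

  Qi-bordered : ∀ i m r t → Qi k lam i (suc m) r t ≡ bordered (Qi-column i) (suc m) r t
  Qi-bordered i m zero    zero          = refl
  Qi-bordered i m zero    (suc zero)    = refl
  Qi-bordered i m zero    (suc (suc t)) = refl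
  Qi-bordered i m (suc r) zero          = refl
  Qi-bordered i m (suc r) (suc t)       = refl

  Q-weight : ℕ → ℕ
  Q-weight zero    = lam
  Q-weight (suc j) = weight 2 j

  Q-column-weights : ∀ j → Q-column j ≡ 1ι ⊗ ιpow j ⊗ fromℕ (Q-weight j)
  Q-column-weights zero    = sym (⊗-identityˡ (fromℕ lam))
  Q-column-weights (suc j) =
    trans (if-else-0ι _ (ιpow (suc j))) (cong (_⊗ fromℕ (weight 2 j)) (sym (⊗-identityˡ (ιpow (suc j)))))

  Qi-condition : ∀ {i} j → i ≤ k → (j + 2 ≤ k ∸ i + 1) ⇔ (i + suc j ≤ k)
  Qi-condition {i} j i≤k = mk⇔
    (λ le → subst (_≤ k) (+-comm (suc j) i)
              (m≤o∸n⇒m+n≤o (suc j) i≤k (≤-pred (subst₂ _≤_ (+-comm j 2) (+-comm (k ∸ i) 1) le))))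
    (λ le → subst₂ _≤_ (+-comm 2 j) (+-comm 1 (k ∸ i))
              (s≤s (m+n≤o⇒m≤o∸n (suc j) (subst (_≤ k) (+-comm i (suc j)) le))))

  Qi-column-weights : ∀ {i} → i ≤ k → ∀ j → Qi-column i j ≡ 1ι ⊗ ιpow j ⊗ fromℕ (weight i j)
  Qi-column-weights i≤k zero    = cong (λ w → 1ι ⊗ 1ι ⊗ fromℕ w) (sym (weight-zero i≤k))
  Qi-column-weights {i} i≤k (suc j) = begin
    (if does (j + 2 ≤? k ∸ i + 1) then ιpow (j + 1) else 0ι)
      ≡⟨ cong₂ (λ c x → if c then x else 0ι)
               (does-⇔ (Qi-condition j i≤k) (j + 2 ≤? k ∸ i + 1) (i + suc j ≤? k)) (cong ιpow (+-comm j 1)) ⟩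
    (if does (i + suc j ≤? k) then ιpow (suc j) else 0ι)
      ≡⟨ if-else-0ι _ (ιpow (suc j)) ⟩
    ιpow (suc j) ⊗ fromℕ (weight i (suc j))
      ≡⟨ cong (_⊗ fromℕ (weight i (suc j))) (⊗-identityˡ (ιpow (suc j))) ⟨
    1ι ⊗ ιpow (suc j) ⊗ fromℕ (weight i (suc j)) ∎

  det-bordered : ∀ m u c w → (∀ j → c j ≡ u ⊗ ιpow j ⊗ fromℕ (w j)) →
                 det (suc m) (bordered c (suc m)) ≡ u ⊗ fromℕ (convolve w (suc m))
  det-Q : ∀ m → det m (Q k lam m) ≡ fromℕ (a₁ m)

  det-bordered zero u c w c≡ = begin
    det 1 (bordered c 1)         ≡⟨ det-singleton (bordered c 1) ⟩
    c 0                          ≡⟨ c≡ 0 ⟩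
    u ⊗ 1ι ⊗ fromℕ (w 0)         ≡⟨ cong (_⊗ fromℕ (w 0)) (⊗-identityʳ u) ⟩
    u ⊗ fromℕ (w 0)              ≡⟨ cong (λ v → u ⊗ fromℕ v) convolve-one ⟨
    u ⊗ fromℕ (convolve w 1)     ∎
    where
    convolve-one : w 0 * a₁ 0 + 0 ≡ w 0
    convolve-one = trans (+-identityʳ (w 0 * a₁ 0)) (trans (cong (w 0 *_) a₁-zero) (*-identityʳ (w 0)))
  det-bordered (suc m) u c w c≡ = begin
    det (2 + m) (bordered c (2 + m))
      ≡⟨ det-expand-first-row₂ m (bordered c (2 + m)) (λ _ → refl) ⟩
    c 0 ⊗ det (suc m) (Q k lam (suc m)) ⊕ ⊖ 1ι ⊗ ι ⊗ det (suc m) (minor (suc zero) (bordered c (2 + m)))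
      ≡⟨ cong₂ _⊕_ (cong₂ _⊗_ (c≡ 0) (det-Q (suc m))) (cong (⊖ 1ι ⊗ ι ⊗_) det-minor) ⟩
    u ⊗ 1ι ⊗ fromℕ (w 0) ⊗ fromℕ (a₁ (suc m)) ⊕ ⊖ 1ι ⊗ ι ⊗ (u ⊗ ι ⊗ fromℕ rest)
      ≡⟨ cong₂ _⊕_ (trans (cong (λ v → v ⊗ fromℕ (w 0) ⊗ fromℕ (a₁ (suc m))) (⊗-identityʳ u))
                          (⊗-assoc u (fromℕ (w 0)) (fromℕ (a₁ (suc m)))))
                   (ι-cancel u (fromℕ rest)) ⟩
    u ⊗ (fromℕ (w 0) ⊗ fromℕ (a₁ (suc m))) ⊕ u ⊗ fromℕ rest
      ≡⟨ ⊗-distribˡ-⊕ u (fromℕ (w 0) ⊗ fromℕ (a₁ (suc m))) (fromℕ rest) ⟨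
    u ⊗ (fromℕ (w 0) ⊗ fromℕ (a₁ (suc m)) ⊕ fromℕ rest)
      ≡⟨ cong (u ⊗_) (trans (fromℕ-+ (w 0 * a₁ (suc m)) rest)
                            (cong (_⊕ fromℕ rest) (fromℕ-* (w 0) (a₁ (suc m))))) ⟨
    u ⊗ fromℕ (convolve w (2 + m)) ∎
    where
    rest : ℕ
    rest = convolve (w ∘ suc) (suc m)
    det-minor : det (suc m) (minor (suc zero) (bordered c (2 + m))) ≡ u ⊗ ι ⊗ fromℕ rest
    det-minor = trans (det-cong (suc m) (minor-bordered c m))
      (det-bordered m (u ⊗ ι) (c ∘ suc) (w ∘ suc)
        (λ j → trans (c≡ (suc j)) (cong (_⊗ fromℕ (w (suc j))) (sym (⊗-assoc u ι (ιpow j))))))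

  det-Q zero    = cong fromℕ (sym a₁-zero)
  det-Q (suc m) = begin
    det (suc m) (Q k lam (suc m))
      ≡⟨ det-cong (suc m) (Q-bordered m) ⟩
    det (suc m) (bordered Q-column (suc m))
      ≡⟨ det-bordered m 1ι Q-column Q-weight Q-column-weights ⟩
    1ι ⊗ fromℕ (lam * a₁ m + convolve (weight 2) m)
      ≡⟨ ⊗-identityˡ _ ⟩
    fromℕ (lam * a₁ m + convolve (weight 2) m)
      ≡⟨ cong (λ v → fromℕ (lam * a₁ m + v)) (a-convolution 2 m ≤-refl (s≤s (s≤s z≤n))) ⟨
    fromℕ (lam * a₁ m + a k lam 2 m)
      ≡⟨ cong fromℕ (a₁-suc m) ⟨
    fromℕ (a₁ (suc m))
      ∎

theorem1p8 : (k i lam n : ℕ) → 2 ≤ k → 2 ≤ i → i ≤ k → 1 ≤ lam → 2 ≤ n →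
    det n (Qi k lam i n) ≡ fromℕ (a k lam i n)
theorem1p8 (suc (suc k″)) i lam (suc m) _ 2≤i i≤k _ _ = begin
  det (suc m) (Qi k lam i (suc m))
    ≡⟨ det-cong (suc m) (Qi-bordered i m) ⟩
  det (suc m) (bordered (Qi-column i) (suc m))
    ≡⟨ det-bordered m 1ι (Qi-column i) (weight i) (Qi-column-weights i≤k) ⟩
  1ι ⊗ fromℕ (convolve (weight i) (suc m))
    ≡⟨ ⊗-identityˡ _ ⟩
  fromℕ (convolve (weight i) (suc m))
    ≡⟨ cong fromℕ (a-convolution i (suc m) 2≤i (m≤n⇒m≤1+n i≤k)) ⟨
  fromℕ (a k lam i (suc m))
    ∎
  where open Determinants k″ lam
theorem1p8 zero          _ _ _       ()        _ _ _ _
theorem1p8 (suc zero)    _ _ _       (s≤s ()) _ _ _ _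
theorem1p8 (suc (suc _)) _ _ zero    _         _ _ _ ()
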